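{- Let $G$ be a digraph, $b\in V(G)$ and $I\subseteq V(G)\setminus\{b\}$ such that $G$ is exact for $b$ and $I$ and every finite subset of $I$ has a linkage into $b$. Let $D$ be exact and let $P_1,\dots,P_n$ be a linkage from $I\cap D$ to $b$. Then each $P_i$ contains precisely one $D$-crossing edge, and each $D$-crossing edge is contained in some $P_i$.
   Context: Paths are finite directed paths; "disjoint" means edge-disjoint. A linkage from a finite set $S$ to $b$ (or into $b$) is a family of pairwise edge-disjoint directed paths, one from each $s\in S$ to $b$. For $D\subseteq V(G)$, an edge is $D$-crossing if its start vertex is in $D$ and its end vertex is not; the order of $D$ is the number of $D$-crossing edges. $D$ is exact (for $I$ and $b$) if $b\notin D$ and the order of $D$ is finite and equal to $|D\cap I|$. $G$ is exact (for $b$ and $I$) if every $v\in V(G)\setminus\{b\}$ lies in some exact set. -}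

module Defs where

open import Data.Bool using (Bool; true; false; not; _∧_; T)
open import Data.Nat using (ℕ)
open import Data.Fin using (Fin)
open import Data.Product using (Σ; ∃; _×_; _,_; proj₁)
open import Data.List using (List; []; _∷_)
open import Data.List.Membership.Propositional using (_∈_)
open import Data.List.Relation.Unary.Unique.Propositional using (Unique)
open import Data.Empty using (⊥)
open import Relation.Nullary using (¬_)
open import Relation.Binary.PropositionalEquality using (_≡_; _≢_)
open import Function.Bundles using (_↔_)

record Digraph : Set₁ where
  field
    V    : Set
    E    : Set
    tail : E → V
    head : E → V

Subset : Set → Set
Subset A = A → Bool

Elems : {A : Set} → Subset A → Set
Elems {A} S = Σ A (λ a → T (S a))

_∩_ : {A : Set} → Subset A → Subset A → Subset A
(S ∩ R) a = S a ∧ R a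

HasSize : Set → ℕ → Set
HasSize X k = Fin k ↔ X

FiniteSubset : {A : Set} → Subset A → Set
FiniteSubset S = ∃ λ k → HasSize (Elems S) k

module _ (G : Digraph) where
  open Digraph G

  data Walk : V → V → Set where
    [] : ∀ {a} → Walk a a
    _∷⟨_⟩_ : ∀ {a c} (e : E) → tail e ≡ a → Walk (head e) c → Walk a c

  vertices : ∀ {a c} → Walk a c → List V
  vertices {a} [] = a ∷ []
  vertices {a} (e ∷⟨ _ ⟩ w) = a ∷ vertices w

  edges : ∀ {a c} → Walk a c → List E
  edges [] = []
  edges (e ∷⟨ _ ⟩ w) = e ∷ edges w

  record Path (a c : V) : Set where
    field
      walk     : Walk a c
      distinct : Unique (vertices walk)
  open Path public

  EdgeDisjoint : ∀ {a c a' c'} → Path a c → Path a' c' → Set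
  EdgeDisjoint P Q = ∀ e → e ∈ edges (walk P) → e ∈ edges (walk Q) → ⊥

  record Linkage (S : Subset V) (b : V) : Set where
    field
      path     : (s : Elems S) → Path (proj₁ s) b
      disjoint : (s t : Elems S) → proj₁ s ≢ proj₁ t → EdgeDisjoint (path s) (path t)
  open Linkage public

  Crossing : Subset V → E → Set
  Crossing D e = T (D (tail e)) × T (not (D (head e)))

  CrossingEdges : Subset V → Set
  CrossingEdges D = Σ E (Crossing D)

  HasOrder : Subset V → ℕ → Set
  HasOrder D k = HasSize (CrossingEdges D) k

  Exact : Subset V → V → Subset V → Set
  Exact I b D = ¬ T (D b) × ∃ λ k → HasOrder D k × HasSize (Elems (D ∩ I)) k

  GraphExact : V → Subset V → Set
  GraphExact b I = ∀ v → v ≢ b → ∃ λ D → Exact I b D × T (D v)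

  _⊆_ : Subset V → Subset V → Set
  S ⊆ R = ∀ v → T (S v) → T (R v)

-- Every path of the linkage starts in D and ends at b ∉ D, so it contains a
-- D-crossing edge. Choosing one per path gives a map from I ∩ D to the
-- D-crossing edges, injective because the paths are edge-disjoint. Exactness
-- says both sets have the same finite size, so the map is a bijection: every
-- crossing edge is chosen by some path, and a second crossing edge on a path
-- would be the chosen edge of another path sharing an edge with it.
module Submission where

open import Defs
open import Data.Bool using (T; true; false)
open import Data.Bool.Properties using (T-irrelevant; ∧-comm; T-≡; T-not-≡; T-∧)
open import Data.Nat using (zero; suc)
open import Data.Nat.Properties using (1+n≰n)
open import Data.Fin using (Fin; punchOut)
open import Data.Fin.Properties using (any?; punchOut-injective; injective⇒≤; _≟_)
open import Data.Product using (Σ; ∃; _×_; proj₁; proj₂; _,_)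
open import Data.List.Membership.Propositional using (_∈_)
open import Data.List.Relation.Unary.Any using (here; there)
open import Data.Empty using (⊥-elim)
open import Relation.Nullary using (¬_; yes; no)
open import Relation.Nullary.Decidable using (map′)
open import Relation.Binary.Definitions using (DecidableEquality)
open import Relation.Binary.PropositionalEquality using (_≡_; _≢_; refl; sym; cong; subst; module ≡-Reasoning)
open import Function.Bundles using (_↔_; Inverse; Injection; Equivalence; mk↔ₛ′)
open import Function.Definitions using (Injective)
open import Function.Properties.Inverse using (↔-sym; ↔-trans; ↔⇒↣)

↔-to-injective : ∀ {A B : Set} (iso : A ↔ B) → Injective _≡_ _≡_ (Inverse.to iso)
↔-to-injective iso = Injection.injective (↔⇒↣ iso)

Fin-injective⇒surjective : ∀ {k} (f : Fin k → Fin k) → Injective _≡_ _≡_ f →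
                           ∀ j → ∃ λ i → f i ≡ j
Fin-injective⇒surjective {zero} f f-inj ()
Fin-injective⇒surjective {suc k} f f-inj j with any? (λ i → f i ≟ j)
... | yes hit = hit
... | no miss = ⊥-elim (1+n≰n (injective⇒≤ g-injective))
  where
  f≢j : ∀ i → j ≢ f i
  f≢j i j≡fi = miss (i , sym j≡fi)

  -- Missing j, f factors through Fin k, which is impossible for an injection.
  g : Fin (suc k) → Fin k
  g i = punchOut (f≢j i)

  g-injective : Injective _≡_ _≡_ g
  g-injective {i} {i′} eq = f-inj (punchOut-injective (f≢j i) (f≢j i′) eq)

module _ {A B : Set} {k} (sizeA : HasSize A k) (sizeB : HasSize B k)
         (f : A → B) (f-injective : Injective _≡_ _≡_ f) where
  private
    module A = Inverse sizeA
    module B = Inverse sizeB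

    g : Fin k → Fin k
    g i = B.from (f (A.to i))

    g-injective : Injective _≡_ _≡_ g
    g-injective eq = ↔-to-injective sizeA (f-injective (↔-to-injective (↔-sym sizeB) eq))

  injective⇒surjective : ∀ y → ∃ λ x → f x ≡ y
  injective⇒surjective y with i , g[i]≡y ← Fin-injective⇒surjective g g-injective (B.from y) =
    A.to i , (begin
      f (A.to i)                 ≡⟨ B.strictlyInverseˡ _ ⟨
      B.to (B.from (f (A.to i))) ≡⟨ cong B.to g[i]≡y ⟩
      B.to (B.from y)            ≡⟨ B.strictlyInverseˡ y ⟩
      y                          ∎)
    where open ≡-Reasoning

sized⇒decidableEquality : ∀ {A : Set} {k} → HasSize A k → DecidableEquality A
sized⇒decidableEquality size x y =
  map′ (↔-to-injective (↔-sym size)) (cong (Inverse.from size)) (Inverse.from size x ≟ Inverse.from size y)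

Elems-≡ : ∀ {A : Set} {S : Subset A} {x y : Elems S} → proj₁ x ≡ proj₁ y → x ≡ y
Elems-≡ {x = a , p} {y = .a , q} refl = cong (a ,_) (T-irrelevant p q)

∩-comm-↔ : ∀ {A : Set} (S R : Subset A) → Elems (S ∩ R) ↔ Elems (R ∩ S)
∩-comm-↔ S R = mk↔ₛ′ (swap S R) (swap R S) (λ _ → Elems-≡ refl) (λ _ → Elems-≡ refl)
  where
  swap : ∀ S R → Elems (S ∩ R) → Elems (R ∩ S)
  swap S R (a , p) = a , subst T (∧-comm (S a) (R a)) p

module _ (G : Digraph) (D : Subset (Digraph.V G)) where
  open Digraph G

  crossing-edge-on-walk : ∀ {a c} (w : Walk G a c) → T (D a) → ¬ T (D c) →
                          Σ E λ e → e ∈ edges G w × Crossing G D e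
  crossing-edge-on-walk [] a∈D a∉D = ⊥-elim (a∉D a∈D)
  crossing-edge-on-walk (e ∷⟨ refl ⟩ w) tail∈D c∉D with D (head e) in D[head]
  ... | false = e , here refl , tail∈D , Equivalence.from T-not-≡ D[head]
  ... | true with e′ , e′∈w , crosses ← crossing-edge-on-walk w (Equivalence.from T-≡ D[head]) c∉D =
    e′ , there e′∈w , crosses

  module _ {S : Subset V} {b : V} {k} (L : Linkage G S b) (S⊆D : _⊆_ G S D) (b∉D : ¬ T (D b))
           (size : HasSize (Elems S) k) (order : HasOrder G D k) where
    private
      -- Disjointness only refutes s ≢ t; finiteness of S makes that enough.
      shared-edge⇒same-source : ∀ {e} s t → e ∈ edges G (walk (path L s)) →
                                e ∈ edges G (walk (path L t)) → s ≡ t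
      shared-edge⇒same-source s t e∈s e∈t with sized⇒decidableEquality size s t
      ... | yes s≡t = s≡t
      ... | no s≢t = ⊥-elim (disjoint L s t (λ eq → s≢t (Elems-≡ eq)) _ e∈s e∈t)

      crossing : (s : Elems S) → Σ E λ e → e ∈ edges G (walk (path L s)) × Crossing G D e
      crossing s = crossing-edge-on-walk (walk (path L s)) (S⊆D _ (proj₂ s)) b∉D

      chosen : Elems S → CrossingEdges G D
      chosen s = proj₁ (crossing s) , proj₂ (proj₂ (crossing s))

      chosen-injective : Injective _≡_ _≡_ chosen
      chosen-injective {s} {t} chosen≡ = shared-edge⇒same-source s t
        (subst (λ e → e ∈ edges G (walk (path L s))) (cong proj₁ chosen≡) (proj₁ (proj₂ (crossing s))))
        (proj₁ (proj₂ (crossing t)))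

      every-crossing-edge-chosen : ∀ e → Crossing G D e → ∃ λ s → proj₁ (crossing s) ≡ e
      every-crossing-edge-chosen e crosses
        with s , chosen[s]≡e ← injective⇒surjective size order chosen chosen-injective (e , crosses) =
        s , cong proj₁ chosen[s]≡e

    linkage-path-crosses-once : (s : Elems S) →
      ∃ λ e → (e ∈ edges G (walk (path L s)) × Crossing G D e) ×
        ((e′ : E) → e′ ∈ edges G (walk (path L s)) → Crossing G D e′ → e′ ≡ e)
    linkage-path-crosses-once s = proj₁ (crossing s) , proj₂ (crossing s) , only
      where
      only : (e′ : E) → e′ ∈ edges G (walk (path L s)) → Crossing G D e′ → e′ ≡ proj₁ (crossing s)
      only e′ e′∈s crosses with t , refl ← every-crossing-edge-chosen e′ crosses
        with refl ← shared-edge⇒same-source s t e′∈s (proj₁ (proj₂ (crossing t))) = refl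

    linkage-covers-crossing-edges : (e : E) → Crossing G D e → ∃ λ s → e ∈ edges G (walk (path L s))
    linkage-covers-crossing-edges e crosses with s , refl ← every-crossing-edge-chosen e crosses =
      s , proj₁ (proj₂ (crossing s))

lemma3p4 : (G : Digraph) (b : Digraph.V G) (I : Subset (Digraph.V G)) →
    ¬ T (I b) →
    GraphExact G b I →
    ((S : Subset (Digraph.V G)) → _⊆_ G S I → FiniteSubset S → Linkage G S b) →
    (D : Subset (Digraph.V G)) → Exact G I b D →
    (L : Linkage G (I ∩ D) b) →
    ((x : Elems (I ∩ D)) →
       ∃ λ e → (e ∈ edges G (walk (path L x)) × Crossing G D e) ×
         ((e' : Digraph.E G) → e' ∈ edges G (walk (path L x)) → Crossing G D e' → e' ≡ e))
    × ((e : Digraph.E G) → Crossing G D e → ∃ λ x → e ∈ edges G (walk (path L x)))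
lemma3p4 G b I _ _ _ D (b∉D , k , order , size[D∩I]) L =
  linkage-path-crosses-once G D L I∩D⊆D b∉D size order ,
  linkage-covers-crossing-edges G D L I∩D⊆D b∉D size order
  where
  I∩D⊆D : _⊆_ G (I ∩ D) D
  I∩D⊆D _ v∈I∩D = proj₂ (Equivalence.to T-∧ v∈I∩D)

  size : HasSize (Elems (I ∩ D)) k
  size = ↔-trans size[D∩I] (∩-comm-↔ D I)
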